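{- Let $T$ be a rooted tree. Then $$\varphi_T(q)=\sum_{\substack{S\in L_T\\ \varphi_S(-1)=1}}(-q)^{r(S)}(1+q)^{c(S)},$$ where for a pruning $S$ of $T$, $r(S)$ is the rank of $S$ in $L_T$ (its number of edges) and $c(S)$ is the number of elements of $L_T$ that cover $S$.
   Context: For a rooted tree $T$ whose root has children that are the roots of subtrees $T_1,\dots,T_m$, the polynomial $\varphi_T(q)$ is defined recursively by $\varphi_T(q)=\prod_{k=1}^m(1+q\,\varphi_{T_k}(q))$ (the empty product being $1$, so $\varphi_T=1$ for a single vertex). A pruning of $T$ is a rooted tree with the same root whose edge set is a subset of the edges of $T$ (a connected subtree containing the root). $L_T$ is the lattice of prunings of $T$ ordered by inclusion of edge sets; a pruning is itself a rooted tree, so $\varphi_S$ is defined for $S\in L_T$. -}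

module Defs where

open import Level using (Level)
open import Data.Bool using (Bool; true; false; _∧_; not; if_then_else_)
open import Data.Nat as ℕ using (ℕ; zero; suc)
open import Data.List using (List; []; _∷_; map; _++_; length; filterᵇ; foldr; concatMap)
open import Data.Bool.ListAction using (any)
open import Data.Integer as ℤ using (ℤ)
open import Data.Integer.Properties using (+-*-commutativeRing)
open import Relation.Nullary using (yes; no)
open import Algebra.Bundles using (CommutativeRing)

data Tree : Set where
  node : List Tree → Tree

-- A pruning of T (connected subtree containing the root).  For node ts, each child
-- edge is either dropped, or kept together with a pruning of the child subtree.
mutual
  data Pruning : Tree → Set where
    prune : ∀ {ts} → Prunings ts → Pruning (node ts)

  data Prunings : List Tree → Set where
    []   : Prunings []
    drop : ∀ {t ts} → Prunings ts → Prunings (t ∷ ts)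
    keep : ∀ {t ts} → Pruning t → Prunings ts → Prunings (t ∷ ts)

mutual
  toTree : ∀ {t} → Pruning t → Tree
  toTree (prune ps) = node (toTrees ps)

  toTrees : ∀ {ts} → Prunings ts → List Tree
  toTrees []          = []
  toTrees (drop ps)   = toTrees ps
  toTrees (keep p ps) = toTree p ∷ toTrees ps

mutual
  allPrunings : (t : Tree) → List (Pruning t)
  allPrunings (node ts) = map prune (allPruningss ts)

  allPruningss : (ts : List Tree) → List (Prunings ts)
  allPruningss []       = [] ∷ []
  allPruningss (t ∷ ts) =
    map drop (allPruningss ts)
    ++ concatMap (λ p → map (keep p) (allPruningss ts)) (allPrunings t)

-- Inclusion of edge sets between two prunings of the same tree (order of L_T).
mutual
  leq : ∀ {t} → Pruning t → Pruning t → Bool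
  leq (prune ps) (prune qs) = leqs ps qs

  leqs : ∀ {ts} → Prunings ts → Prunings ts → Bool
  leqs []          []          = true
  leqs (drop ps)   (drop qs)   = leqs ps qs
  leqs (drop ps)   (keep q qs) = leqs ps qs
  leqs (keep p ps) (drop qs)   = false
  leqs (keep p ps) (keep q qs) = leq p q ∧ leqs ps qs

lt : ∀ {t} → Pruning t → Pruning t → Bool
lt S U = leq S U ∧ not (leq U S)

covers : ∀ {t} → Pruning t → Pruning t → Bool
covers {t} S U = lt S U ∧ not (any (λ V → lt S V ∧ lt V U) (allPrunings t))

coverCount : ∀ {t} → Pruning t → ℕ
coverCount {t} S = length (filterᵇ (covers S) (allPrunings t))

mutual
  edges : Tree → ℕ
  edges (node ts) = edgess ts

  edgess : List Tree → ℕ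
  edgess []       = 0
  edgess (t ∷ ts) = suc (edges t ℕ.+ edgess ts)

rank : ∀ {t} → Pruning t → ℕ
rank S = edges (toTree S)

-- φ_T evaluated at an element q of an arbitrary commutative ring.  A polynomial
-- identity over ℤ[q] is stated as: it holds for every q in every commutative ring.
module Poly {c ℓ : Level} (R : CommutativeRing c ℓ) where
  open CommutativeRing R

  pow : Carrier → ℕ → Carrier
  pow x zero    = 1#
  pow x (suc n) = x * pow x n

  mutual
    φ : Carrier → Tree → Carrier
    φ q (node ts) = φs q ts

    φs : Carrier → List Tree → Carrier
    φs q []       = 1#
    φs q (t ∷ ts) = (1# + q * φ q t) * φs q ts

  sumR : List Carrier → Carrier
  sumR = foldr _+_ 0#

φℤ : ℤ → Tree → ℤ
φℤ = Poly.φ +-*-commutativeRing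

φAtMinusOneIsOne : ∀ {t} → Pruning t → Bool
φAtMinusOneIsOne S with φℤ (ℤ.- ℤ.1ℤ) (toTree S) ℤ.≟ ℤ.1ℤ
... | yes _ = true
... | no  _ = false

module RHS {c ℓ : Level} (R : CommutativeRing c ℓ) where
  open CommutativeRing R
  open Poly R

  rhs : Carrier → Tree → Carrier
  rhs q T = sumR (map (λ S → pow (- q) (rank S) * pow (1# + q) (coverCount S))
                      (filterᵇ φAtMinusOneIsOne (allPrunings T)))

{-# OPTIONS --safe #-}
-- Give a pruning S the weight w(S) = (-q)^r(S) (1+q)^c(S).  A cover of S is obtained by adding one
-- edge of T leaving S, so c(S) is the number of such boundary edges.  Since φ_S(-1) is 0 or 1, the
-- right-hand side is F_T = Σ_S φ_S(-1) w(S).  A pruning of the forest below the root decides for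
-- each child edge independently whether to drop it (factor 1+q) or to keep it together with a
-- pruning p of the child (factor -q w(p), and φ_S(-1) acquires the factor 1 - φ_p(-1)).  Hence the
-- total weight W_T = Σ_S w(S) satisfies W_T = Π_k ((1+q) - q W_{T_k}) = 1, and then
-- F_T = Π_k ((1+q) - q (W_{T_k} - F_{T_k})) = Π_k (1 + q F_{T_k}), the recursion defining φ_T.
module Submission where

open import Defs
open import Level using (Level)
open import Algebra.Bundles using (CommutativeRing; CommutativeSemiring)
open import Data.Bool using (Bool; true; false; T; _∧_; not; if_then_else_)
import Data.Integer as ℤ
open import Data.Integer.Properties using (+-*-commutativeRing)
open import Data.List using (List; []; _∷_; map; _++_; length; filterᵇ; foldr; concatMap)
import Data.Nat as ℕ
open import Function using (_∘_)
import Relation.Binary.PropositionalEquality as ≡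
open import Relation.Nullary using (yes; no; contradiction)

module FiniteSum {a ℓ} (S : CommutativeSemiring a ℓ) where
  open CommutativeSemiring S
  open import Relation.Binary.Reasoning.Setoid setoid
  open import Algebra.Properties.CommutativeSemigroup +-commutativeSemigroup using (interchange)
  open import Data.List.Properties using (map-∘)

  𝟙 : Bool → Carrier
  𝟙 b = if b then 1# else 0#

  ∑ : ∀ {A : Set} → List A → (A → Carrier) → Carrier
  ∑ xs f = foldr _+_ 0# (map f xs)

  module _ {A : Set} where

    ∑-cong : ∀ {f g : A → Carrier} → (∀ x → f x ≈ g x) → ∀ xs → ∑ xs f ≈ ∑ xs g
    ∑-cong f≈g []       = refl
    ∑-cong f≈g (x ∷ xs) = +-cong (f≈g x) (∑-cong f≈g xs)

    ∑-zero : ∀ (xs : List A) → ∑ xs (λ _ → 0#) ≈ 0#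
    ∑-zero []       = refl
    ∑-zero (x ∷ xs) = trans (+-identityˡ _) (∑-zero xs)

    ∑-++ : ∀ xs ys (f : A → Carrier) → ∑ (xs ++ ys) f ≈ ∑ xs f + ∑ ys f
    ∑-++ []       ys f = sym (+-identityˡ _)
    ∑-++ (x ∷ xs) ys f = trans (+-congˡ (∑-++ xs ys f)) (sym (+-assoc _ _ _))

    ∑-+ : ∀ xs (f g : A → Carrier) → ∑ xs (λ x → f x + g x) ≈ ∑ xs f + ∑ xs g
    ∑-+ []       f g = sym (+-identityˡ 0#)
    ∑-+ (x ∷ xs) f g = trans (+-congˡ (∑-+ xs f g)) (interchange _ _ _ _)

    ∑-*ˡ : ∀ c xs (f : A → Carrier) → ∑ xs (λ x → c * f x) ≈ c * ∑ xs f
    ∑-*ˡ c []       f = sym (zeroʳ c)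
    ∑-*ˡ c (x ∷ xs) f = trans (+-congˡ (∑-*ˡ c xs f)) (sym (distribˡ c _ _))

    ∑-*ʳ : ∀ c xs (f : A → Carrier) → ∑ xs (λ x → f x * c) ≈ ∑ xs f * c
    ∑-*ʳ c []       f = sym (zeroˡ c)
    ∑-*ʳ c (x ∷ xs) f = trans (+-congˡ (∑-*ʳ c xs f)) (sym (distribʳ c _ _))

    ∑-filterᵇ : ∀ (P : A → Bool) xs f → ∑ (filterᵇ P xs) f ≈ ∑ xs (λ x → 𝟙 (P x) * f x)
    ∑-filterᵇ P []       f = refl
    ∑-filterᵇ P (x ∷ xs) f with P x
    ... | true  = +-cong (sym (*-identityˡ (f x))) (∑-filterᵇ P xs f)
    ... | false = trans (∑-filterᵇ P xs f) (sym (trans (+-congʳ (zeroˡ (f x))) (+-identityˡ _)))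

  ∑-map : ∀ {A B : Set} (g : A → B) xs (f : B → Carrier) → ∑ (map g xs) f ≡.≡ ∑ xs (f ∘ g)
  ∑-map g xs f = ≡.cong (foldr _+_ 0#) (≡.sym (map-∘ xs))

  ∑-concatMap : ∀ {A B : Set} (h : A → List B) xs (f : B → Carrier) →
                ∑ (concatMap h xs) f ≈ ∑ xs (λ x → ∑ (h x) f)
  ∑-concatMap h []       f = refl
  ∑-concatMap h (x ∷ xs) f = trans (∑-++ (h x) (concatMap h xs) f) (+-congˡ (∑-concatMap h xs f))

  ∑-product : ∀ {A B : Set} xs ys (f : A → Carrier) (g : B → Carrier) →
              ∑ xs (λ x → ∑ ys (λ y → f x * g y)) ≈ ∑ xs f * ∑ ys g
  ∑-product xs ys f g = trans (∑-cong (λ x → ∑-*ˡ (f x) ys g) xs) (∑-*ʳ (∑ ys g) xs f)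

  ∑-product-+ : ∀ {A B : Set} xs ys (f f′ : A → Carrier) (g g′ : B → Carrier) →
                ∑ xs (λ x → ∑ ys (λ y → f x * g y + f′ x * g′ y)) ≈ ∑ xs f * ∑ ys g + ∑ xs f′ * ∑ ys g′
  ∑-product-+ xs ys f f′ g g′ = begin
    ∑ xs (λ x → ∑ ys (λ y → f x * g y + f′ x * g′ y))
      ≈⟨ ∑-cong (λ x → ∑-+ ys (λ y → f x * g y) (λ y → f′ x * g′ y)) xs ⟩
    ∑ xs (λ x → ∑ ys (λ y → f x * g y) + ∑ ys (λ y → f′ x * g′ y))
      ≈⟨ ∑-+ xs (λ x → ∑ ys (λ y → f x * g y)) (λ x → ∑ ys (λ y → f′ x * g′ y)) ⟩
    ∑ xs (λ x → ∑ ys (λ y → f x * g y)) + ∑ xs (λ x → ∑ ys (λ y → f′ x * g′ y))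
      ≈⟨ +-cong (∑-product xs ys f g) (∑-product xs ys f′ g′) ⟩
    ∑ xs f * ∑ ys g + ∑ xs f′ * ∑ ys g′ ∎

  ∑-allPrunings-node : ∀ {ts} (f : Pruning (node ts) → Carrier) →
                       ∑ (allPrunings (node ts)) f ≡.≡ ∑ (allPruningss ts) (f ∘ prune)
  ∑-allPrunings-node {ts} = ∑-map prune (allPruningss ts)

  ∑-allPruningss-∷ : ∀ {t ts} (f : Prunings (t ∷ ts) → Carrier) →
    ∑ (allPruningss (t ∷ ts)) f ≈
    ∑ (allPruningss ts) (f ∘ drop) + ∑ (allPrunings t) (λ p → ∑ (allPruningss ts) (f ∘ keep p))
  ∑-allPruningss-∷ {t} {ts} f = begin
    ∑ (map drop A ++ concatMap (λ p → map (keep p) A) (allPrunings t)) f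
      ≈⟨ ∑-++ (map drop A) _ f ⟩
    ∑ (map drop A) f + ∑ (concatMap (λ p → map (keep p) A) (allPrunings t)) f
      ≈⟨ +-cong (reflexive (∑-map drop A f)) (∑-concatMap _ (allPrunings t) f) ⟩
    ∑ A (f ∘ drop) + ∑ (allPrunings t) (λ p → ∑ (map (keep p) A) f)
      ≈⟨ +-congˡ (∑-cong (λ p → reflexive (∑-map (keep p) A f)) (allPrunings t)) ⟩
    ∑ A (f ∘ drop) + ∑ (allPrunings t) (λ p → ∑ A (f ∘ keep p)) ∎
    where
    A : List (Prunings ts)
    A = allPruningss ts

  ∑-allPruningss-∷-factor : ∀ {t ts} (f : Prunings (t ∷ ts) → Carrier)
    (c : Carrier) (h : Pruning t → Carrier) (g : Prunings ts → Carrier) →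
    (∀ ps → f (drop ps) ≈ c * g ps) → (∀ p ps → f (keep p ps) ≈ h p * g ps) →
    ∑ (allPruningss (t ∷ ts)) f ≈ (c + ∑ (allPrunings t) h) * ∑ (allPruningss ts) g
  ∑-allPruningss-∷-factor {t} {ts} f c h g f-drop f-keep = begin
    ∑ (allPruningss (t ∷ ts)) f
      ≈⟨ ∑-allPruningss-∷ f ⟩
    ∑ A (f ∘ drop) + ∑ (allPrunings t) (λ p → ∑ A (f ∘ keep p))
      ≈⟨ +-cong (∑-cong f-drop A) (∑-cong (λ p → ∑-cong (f-keep p) A) (allPrunings t)) ⟩
    ∑ A (λ ps → c * g ps) + ∑ (allPrunings t) (λ p → ∑ A (λ ps → h p * g ps))
      ≈⟨ +-cong (∑-*ˡ c A g) (∑-product (allPrunings t) A h g) ⟩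
    c * ∑ A g + ∑ (allPrunings t) h * ∑ A g
      ≈⟨ distribʳ (∑ A g) c _ ⟨
    (c + ∑ (allPrunings t) h) * ∑ A g ∎
    where
    A : List (Prunings ts)
    A = allPruningss ts

module _ where
  open import Data.Bool.Properties using (T-∧; T-≡; ∧-zeroʳ)
  open import Data.Bool.ListAction using (any)
  open import Data.List.Membership.Propositional using (_∈_; lose)
  open import Data.List.Membership.Propositional.Properties using (∈-map⁺; ∈-++⁺ˡ; ∈-++⁺ʳ; ∈-concatMap⁺)
  open import Data.List.Relation.Unary.Any using (here; satisfied)
  open import Data.List.Relation.Unary.Any.Properties using (any⁺; any⁻)
  open import Data.Nat using (ℕ; zero; suc; _+_; _*_; _≡ᵇ_; _<_; _≤_; s≤s)
  open import Data.Nat.Properties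
    using ( +-commutativeSemigroup; +-*-commutativeSemiring; _≟_; +-assoc; +-suc; +-comm; +-identityʳ
          ; *-identityˡ; *-identityʳ; *-zeroʳ; m+n≡0⇒m≡0; m+n≡0⇒n≡0; m≤n+m; m<n+m; n≢0⇒n>0; n<1+n
          ; ≤-pred; <⇒≱; <-irrefl; ≡ᵇ⇒≡; ≡⇒≡ᵇ )
  open import Algebra.Properties.CommutativeSemigroup +-commutativeSemigroup using (interchange)
  open import Data.Product using (∃-syntax; _×_; _,_; proj₁; proj₂)
  import Data.Product as Σ
  open import Function using (id; _⇔_; mk⇔; Equivalence)
  open ≡ using (_≡_; _≢_; refl; sym; trans; cong; cong₂; subst; subst₂)
  open ≡.≡-Reasoning
  open import Relation.Nullary using (¬_)

  T-∧⁺ : ∀ {a b} → T a → T b → T (a ∧ b)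
  T-∧⁺ x y = Equivalence.from T-∧ (x , y)

  T-∧⁻ : ∀ {a b} → T (a ∧ b) → T a × T b
  T-∧⁻ = Equivalence.to T-∧

  T-not : ∀ {b} → T (not b) ⇔ (¬ T b)
  T-not {true}  = mk⇔ (λ ()) (λ ¬t → ¬t _)
  T-not {false} = mk⇔ (λ _ ()) (λ _ → _)

  T-injective : ∀ {a b} → T a ⇔ T b → a ≡ b
  T-injective {true}  {true}  _   = refl
  T-injective {true}  {false} a⇔b = contradiction _ (Equivalence.to a⇔b)
  T-injective {false} {true}  a⇔b = contradiction _ (Equivalence.from a⇔b)
  T-injective {false} {false} _   = refl

  -- The order on prunings

  ranks : ∀ {ts} → Prunings ts → ℕ
  ranks ps = edgess (toTrees ps)

  -- extraEdges S U counts the edges of U outside S; the value is junk unless S ≤ U.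
  mutual
    extraEdges : ∀ {t} → Pruning t → Pruning t → ℕ
    extraEdges (prune ps) (prune qs) = extraEdgess ps qs

    extraEdgess : ∀ {ts} → Prunings ts → Prunings ts → ℕ
    extraEdgess []          []          = 0
    extraEdgess (drop ps)   (drop qs)   = extraEdgess ps qs
    extraEdgess (drop ps)   (keep q qs) = suc (rank q + extraEdgess ps qs)
    extraEdgess (keep p ps) (drop qs)   = 0
    extraEdgess (keep p ps) (keep q qs) = extraEdges p q + extraEdgess ps qs

  mutual
    leq-refl : ∀ {t} (S : Pruning t) → T (leq S S)
    leq-refl (prune ps) = leqs-refl ps

    leqs-refl : ∀ {ts} (ps : Prunings ts) → T (leqs ps ps)
    leqs-refl []          = _
    leqs-refl (drop ps)   = leqs-refl ps
    leqs-refl (keep p ps) = T-∧⁺ (leq-refl p) (leqs-refl ps)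

  mutual
    extraEdges-refl : ∀ {t} (S : Pruning t) → extraEdges S S ≡ 0
    extraEdges-refl (prune ps) = extraEdgess-refl ps

    extraEdgess-refl : ∀ {ts} (ps : Prunings ts) → extraEdgess ps ps ≡ 0
    extraEdgess-refl []          = refl
    extraEdgess-refl (drop ps)   = extraEdgess-refl ps
    extraEdgess-refl (keep p ps) = cong₂ _+_ (extraEdges-refl p) (extraEdgess-refl ps)

  mutual
    rank-extraEdges : ∀ {t} (S U : Pruning t) → T (leq S U) → rank U ≡ extraEdges S U + rank S
    rank-extraEdges (prune ps) (prune qs) = ranks-extraEdgess ps qs

    ranks-extraEdgess : ∀ {ts} (ps qs : Prunings ts) → T (leqs ps qs) →
                        ranks qs ≡ extraEdgess ps qs + ranks ps
    ranks-extraEdgess []          []          _  = refl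
    ranks-extraEdgess (drop ps)   (drop qs)   le = ranks-extraEdgess ps qs le
    ranks-extraEdgess (drop ps)   (keep q qs) le =
      cong suc (trans (cong (rank q +_) (ranks-extraEdgess ps qs le)) (sym (+-assoc (rank q) _ (ranks ps))))
    ranks-extraEdgess (keep p ps) (keep q qs) le with T-∧⁻ le
    ... | p≤q , ps≤qs = begin
      suc (rank q + ranks qs)
        ≡⟨ cong suc (cong₂ _+_ (rank-extraEdges p q p≤q) (ranks-extraEdgess ps qs ps≤qs)) ⟩
      suc ((extraEdges p q + rank p) + (extraEdgess ps qs + ranks ps))
        ≡⟨ cong suc (interchange (extraEdges p q) (rank p) (extraEdgess ps qs) (ranks ps)) ⟩
      suc ((extraEdges p q + extraEdgess ps qs) + (rank p + ranks ps))
        ≡⟨ sym (+-suc _ _) ⟩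
      (extraEdges p q + extraEdgess ps qs) + suc (rank p + ranks ps) ∎

  mutual
    extraEdges≡0⇒≡ : ∀ {t} (S U : Pruning t) → T (leq S U) → extraEdges S U ≡ 0 → S ≡ U
    extraEdges≡0⇒≡ (prune ps) (prune qs) le e = cong prune (extraEdgess≡0⇒≡ ps qs le e)

    extraEdgess≡0⇒≡ : ∀ {ts} (ps qs : Prunings ts) → T (leqs ps qs) → extraEdgess ps qs ≡ 0 → ps ≡ qs
    extraEdgess≡0⇒≡ []          []          _  _ = refl
    extraEdgess≡0⇒≡ (drop ps)   (drop qs)   le e = cong drop (extraEdgess≡0⇒≡ ps qs le e)
    extraEdgess≡0⇒≡ (keep p ps) (keep q qs) le e with T-∧⁻ le
    ... | p≤q , ps≤qs = cong₂ keep (extraEdges≡0⇒≡ p q p≤q (m+n≡0⇒m≡0 _ e))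
                                   (extraEdgess≡0⇒≡ ps qs ps≤qs (m+n≡0⇒n≡0 _ e))

  bottoms : (ts : List Tree) → Prunings ts
  bottoms []       = []
  bottoms (t ∷ ts) = drop (bottoms ts)

  bottom : (t : Tree) → Pruning t
  bottom (node ts) = prune (bottoms ts)

  leq-bottom : ∀ {t} (U : Pruning t) → T (leq (bottom t) U)
  leq-bottom (prune qs) = leqs-bottoms qs
    where
    leqs-bottoms : ∀ {ts} (qs : Prunings ts) → T (leqs (bottoms ts) qs)
    leqs-bottoms []          = _
    leqs-bottoms (drop qs)   = leqs-bottoms qs
    leqs-bottoms (keep q qs) = leqs-bottoms qs

  rank-bottom : ∀ t → rank (bottom t) ≡ 0
  rank-bottom (node ts) = ranks-bottoms ts
    where
    ranks-bottoms : ∀ ts → ranks (bottoms ts) ≡ 0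
    ranks-bottoms []       = refl
    ranks-bottoms (t ∷ ts) = ranks-bottoms ts

  extraEdges-bottom : ∀ {t} (U : Pruning t) → extraEdges (bottom t) U ≡ rank U
  extraEdges-bottom {t} U = begin
    extraEdges (bottom t) U                   ≡⟨ +-identityʳ _ ⟨
    extraEdges (bottom t) U + 0               ≡⟨ cong (extraEdges (bottom t) U +_) (rank-bottom t) ⟨
    extraEdges (bottom t) U + rank (bottom t) ≡⟨ rank-extraEdges (bottom t) U (leq-bottom U) ⟨
    rank U                                    ∎

  mutual
    oneEdgeExtension : ∀ {t} (S U : Pruning t) → T (leq S U) → extraEdges S U ≢ 0 →
                       ∃[ V ] T (leq S V) × T (leq V U) × extraEdges S V ≡ 1
    oneEdgeExtension (prune ps) (prune qs) le ne = Σ.map prune id (oneEdgeExtensions ps qs le ne)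

    oneEdgeExtensions : ∀ {ts} (ps qs : Prunings ts) → T (leqs ps qs) → extraEdgess ps qs ≢ 0 →
                        ∃[ vs ] T (leqs ps vs) × T (leqs vs qs) × extraEdgess ps vs ≡ 1
    oneEdgeExtensions []        []        _  ne = contradiction refl ne
    oneEdgeExtensions (drop ps) (drop qs) le ne = Σ.map drop id (oneEdgeExtensions ps qs le ne)
    oneEdgeExtensions {t ∷ _} (drop ps) (keep q qs) le _ =
      keep (bottom t) ps , leqs-refl ps , T-∧⁺ (leq-bottom q) le ,
      cong suc (cong₂ _+_ (rank-bottom t) (extraEdgess-refl ps))
    oneEdgeExtensions (keep p ps) (keep q qs) le ne with T-∧⁻ le | extraEdges p q ≟ 0
    ... | p≤q , ps≤qs | no p≢q with oneEdgeExtension p q p≤q p≢q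
    ...   | p′ , p≤p′ , p′≤q , e = keep p′ ps , T-∧⁺ p≤p′ (leqs-refl ps) , T-∧⁺ p′≤q ps≤qs ,
                                   cong₂ _+_ e (extraEdgess-refl ps)
    oneEdgeExtensions (keep p ps) (keep q qs) le ne | p≤q , ps≤qs | yes p≡q
      with oneEdgeExtensions ps qs ps≤qs (ne ∘ cong₂ _+_ p≡q)
    ...   | vs , ps≤vs , vs≤qs , e = keep p vs , T-∧⁺ (leq-refl p) ps≤vs , T-∧⁺ p≤q vs≤qs ,
                                     cong₂ _+_ (extraEdges-refl p) e

  mutual
    ∈-allPrunings : ∀ {t} (S : Pruning t) → S ∈ allPrunings t
    ∈-allPrunings (prune ps) = ∈-map⁺ prune (∈-allPruningss ps)

    ∈-allPruningss : ∀ {ts} (ps : Prunings ts) → ps ∈ allPruningss ts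
    ∈-allPruningss []          = here refl
    ∈-allPruningss (drop ps)   = ∈-++⁺ˡ (∈-map⁺ drop (∈-allPruningss ps))
    ∈-allPruningss {_ ∷ ts} (keep p ps) =
      ∈-++⁺ʳ (map drop (allPruningss ts))
        (∈-concatMap⁺ (λ p′ → map (keep p′) (allPruningss ts)) (lose (∈-allPrunings p) (∈-map⁺ (keep p) (∈-allPruningss ps))))

  lt⇒rank< : ∀ {t} (S U : Pruning t) → T (lt S U) → rank S < rank U
  lt⇒rank< S U S<U with T-∧⁻ S<U
  ... | S≤U , U≰S = subst (rank S <_) (sym (rank-extraEdges S U S≤U)) (m<n+m (rank S) (n≢0⇒n>0 e≢0))
    where
    e≢0 : extraEdges S U ≢ 0
    e≢0 e≡0 = Equivalence.to T-not U≰S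
                (subst (λ V → T (leq V S)) (extraEdges≡0⇒≡ S U S≤U e≡0) (leq-refl S))

  leq∧rank<⇒lt : ∀ {t} (S U : Pruning t) → T (leq S U) → rank S < rank U → T (lt S U)
  leq∧rank<⇒lt S U S≤U S<U = T-∧⁺ S≤U (Equivalence.from T-not U≰S)
    where
    U≰S : ¬ T (leq U S)
    U≰S U≤S = <⇒≱ S<U (subst (rank U ≤_) (sym (rank-extraEdges U S U≤S)) (m≤n+m (rank U) _))

  covers⇒extraEdges≡1 : ∀ {t} (S U : Pruning t) → T (covers S U) → extraEdges S U ≡ 1
  covers⇒extraEdges≡1 {t} S U c = go (extraEdges S U) refl
    where
    S<U : T (lt S U)
    S<U = proj₁ (T-∧⁻ c)

    S≤U : T (leq S U)
    S≤U = proj₁ (T-∧⁻ S<U)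

    nothingBetween : ¬ T (any (λ V → lt S V ∧ lt V U) (allPrunings t))
    nothingBetween = Equivalence.to T-not (proj₂ (T-∧⁻ c))

    rank-U : ∀ {e} → extraEdges S U ≡ e → rank U ≡ e + rank S
    rank-U {e} eq = trans (rank-extraEdges S U S≤U) (cong (_+ rank S) eq)

    go : ∀ e → extraEdges S U ≡ e → e ≡ 1
    go zero          eq = contradiction (lt⇒rank< S U S<U) (<-irrefl (sym (rank-U eq)))
    go (suc zero)    eq = refl
    -- adding just one of the extra edges gives a pruning strictly between S and U
    go (suc (suc k)) eq with oneEdgeExtension S U S≤U (λ eq′ → contradiction (trans (sym eq) eq′) λ ())
    ... | V , S≤V , V≤U , eV = contradiction (any⁺ _ (lose (∈-allPrunings V) (T-∧⁺ S<V V<U))) nothingBetween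
      where
      rank-V : rank V ≡ suc (rank S)
      rank-V = trans (rank-extraEdges S V S≤V) (cong (_+ rank S) eV)

      S<V : T (lt S V)
      S<V = leq∧rank<⇒lt S V S≤V (subst (rank S <_) (sym rank-V) (n<1+n (rank S)))

      V<U : T (lt V U)
      V<U = leq∧rank<⇒lt V U V≤U
              (subst₂ _<_ (sym rank-V) (sym (rank-U eq)) (s≤s (s≤s (m≤n+m (rank S) k))))

  extraEdges≡1⇒covers : ∀ {t} (S U : Pruning t) → T (leq S U) → extraEdges S U ≡ 1 → T (covers S U)
  extraEdges≡1⇒covers {t} S U S≤U e≡1 =
    T-∧⁺ (leq∧rank<⇒lt S U S≤U (subst (rank S <_) (sym rank-U) (n<1+n (rank S))))
         (Equivalence.from T-not nothingBetween)
    where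
    rank-U : rank U ≡ suc (rank S)
    rank-U = trans (rank-extraEdges S U S≤U) (cong (_+ rank S) e≡1)

    nothingBetween : ¬ T (any (λ V → lt S V ∧ lt V U) (allPrunings t))
    nothingBetween between with satisfied (any⁻ (λ V → lt S V ∧ lt V U) (allPrunings t) between)
    ... | V , S<V<U = <⇒≱ (lt⇒rank< S V S<V) (≤-pred (subst (rank V <_) rank-U (lt⇒rank< V U V<U)))
      where
      S<V : T (lt S V)
      S<V = proj₁ (T-∧⁻ {lt S V} S<V<U)
      V<U : T (lt V U)
      V<U = proj₂ (T-∧⁻ {lt S V} S<V<U)

  covers≡leq∧extraEdges≡ᵇ1 : ∀ {t} (S U : Pruning t) → covers S U ≡ (leq S U ∧ (extraEdges S U ≡ᵇ 1))
  covers≡leq∧extraEdges≡ᵇ1 S U = T-injective (mk⇔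
    (λ c → T-∧⁺ (proj₁ (T-∧⁻ (proj₁ (T-∧⁻ c)))) (≡⇒≡ᵇ _ 1 (covers⇒extraEdges≡1 S U c)))
    (λ h → extraEdges≡1⇒covers S U (proj₁ (T-∧⁻ h)) (≡ᵇ⇒≡ _ 1 (proj₂ (T-∧⁻ h)))))

  -- Counting covers

  open FiniteSum +-*-commutativeSemiring

  length-filterᵇ : ∀ {A : Set} (P : A → Bool) xs → length (filterᵇ P xs) ≡ ∑ xs (𝟙 ∘ P)
  length-filterᵇ P []       = refl
  length-filterᵇ P (x ∷ xs) with P x
  ... | true  = cong suc (length-filterᵇ P xs)
  ... | false = length-filterᵇ P xs

  𝟙-∧-+≡ᵇ0 : ∀ a b x y → 𝟙 ((a ∧ b) ∧ (x + y ≡ᵇ 0)) ≡ 𝟙 (a ∧ (x ≡ᵇ 0)) * 𝟙 (b ∧ (y ≡ᵇ 0))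
  𝟙-∧-+≡ᵇ0 false b     x       y = refl
  𝟙-∧-+≡ᵇ0 true  false x       y = sym (*-zeroʳ (𝟙 (x ≡ᵇ 0)))
  𝟙-∧-+≡ᵇ0 true  true  zero    y = sym (*-identityˡ _)
  𝟙-∧-+≡ᵇ0 true  true  (suc x) y = refl

  𝟙-∧-+≡ᵇ1 : ∀ a b x y → 𝟙 ((a ∧ b) ∧ (x + y ≡ᵇ 1)) ≡
             𝟙 (a ∧ (x ≡ᵇ 1)) * 𝟙 (b ∧ (y ≡ᵇ 0)) + 𝟙 (a ∧ (x ≡ᵇ 0)) * 𝟙 (b ∧ (y ≡ᵇ 1))
  𝟙-∧-+≡ᵇ1 false b     x             y = refl
  𝟙-∧-+≡ᵇ1 true  false x             y = sym (cong₂ _+_ (*-zeroʳ (𝟙 (x ≡ᵇ 1))) (*-zeroʳ (𝟙 (x ≡ᵇ 0))))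
  𝟙-∧-+≡ᵇ1 true  true  zero          y = sym (*-identityˡ _)
  𝟙-∧-+≡ᵇ1 true  true  (suc zero)    y = sym (trans (+-identityʳ _) (*-identityˡ _))
  𝟙-∧-+≡ᵇ1 true  true  (suc (suc x)) y = refl

  mutual
    boundaryEdges : ∀ {t} → Pruning t → ℕ
    boundaryEdges (prune ps) = boundaryEdgess ps

    boundaryEdgess : ∀ {ts} → Prunings ts → ℕ
    boundaryEdgess []          = 0
    boundaryEdgess (drop ps)   = suc (boundaryEdgess ps)
    boundaryEdgess (keep p ps) = boundaryEdges p + boundaryEdgess ps

  aboveBy : ∀ {t} → ℕ → Pruning t → Pruning t → ℕ
  aboveBy k S U = 𝟙 (leq S U ∧ (extraEdges S U ≡ᵇ k))

  aboveBys : ∀ {ts} → ℕ → Prunings ts → Prunings ts → ℕ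
  aboveBys k ps qs = 𝟙 (leqs ps qs ∧ (extraEdgess ps qs ≡ᵇ k))

  mutual
    ∑-aboveBy-0 : ∀ {t} (S : Pruning t) → ∑ (allPrunings t) (aboveBy 0 S) ≡ 1
    ∑-aboveBy-0 (prune ps) = trans (∑-allPrunings-node (aboveBy 0 (prune ps))) (∑-aboveBys-0 ps)

    ∑-aboveBys-0 : ∀ {ts} (ps : Prunings ts) → ∑ (allPruningss ts) (aboveBys 0 ps) ≡ 1
    ∑-aboveBys-0 []                   = refl
    ∑-aboveBys-0 {t ∷ ts} (drop ps)   = begin
      ∑ (allPruningss (t ∷ ts)) (aboveBys 0 (drop ps))
        ≡⟨ ∑-allPruningss-∷-factor _ 1 (λ _ → 0) (aboveBys 0 ps)
             (λ qs → sym (*-identityˡ _)) (λ q qs → cong 𝟙 (∧-zeroʳ (leqs ps qs))) ⟩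
      (1 + ∑ (allPrunings t) (λ _ → 0)) * ∑ (allPruningss ts) (aboveBys 0 ps)
        ≡⟨ cong₂ (λ m n → (1 + m) * n) (∑-zero (allPrunings t)) (∑-aboveBys-0 ps) ⟩
      1 ∎
    ∑-aboveBys-0 {t ∷ ts} (keep p ps) = begin
      ∑ (allPruningss (t ∷ ts)) (aboveBys 0 (keep p ps))
        ≡⟨ ∑-allPruningss-∷-factor _ 0 (aboveBy 0 p) (aboveBys 0 ps) (λ qs → refl)
             (λ q qs → 𝟙-∧-+≡ᵇ0 (leq p q) (leqs ps qs) (extraEdges p q) (extraEdgess ps qs)) ⟩
      ∑ (allPrunings t) (aboveBy 0 p) * ∑ (allPruningss ts) (aboveBys 0 ps)
        ≡⟨ cong₂ _*_ (∑-aboveBy-0 p) (∑-aboveBys-0 ps) ⟩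
      1 ∎

  ∑-rank≡0 : ∀ t → ∑ (allPrunings t) (λ U → 𝟙 (rank U ≡ᵇ 0)) ≡ 1
  ∑-rank≡0 t = trans (∑-cong aboveBottom (allPrunings t)) (∑-aboveBy-0 (bottom t))
    where
    aboveBottom : ∀ U → 𝟙 (rank U ≡ᵇ 0) ≡ aboveBy 0 (bottom t) U
    aboveBottom U rewrite Equivalence.to T-≡ (leq-bottom U) | extraEdges-bottom U = refl

  mutual
    ∑-aboveBy-1 : ∀ {t} (S : Pruning t) → ∑ (allPrunings t) (aboveBy 1 S) ≡ boundaryEdges S
    ∑-aboveBy-1 (prune ps) = trans (∑-allPrunings-node (aboveBy 1 (prune ps))) (∑-aboveBys-1 ps)

    ∑-aboveBys-1 : ∀ {ts} (ps : Prunings ts) → ∑ (allPruningss ts) (aboveBys 1 ps) ≡ boundaryEdgess ps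
    ∑-aboveBys-1 []                 = refl
    ∑-aboveBys-1 {t ∷ ts} (drop ps) = begin
      ∑ (allPruningss (t ∷ ts)) (aboveBys 1 (drop ps))
        ≡⟨ ∑-allPruningss-∷ (aboveBys 1 (drop ps)) ⟩
      ∑ A (aboveBys 1 ps) + ∑ P (λ q → ∑ A (λ qs → 𝟙 (leqs ps qs ∧ (rank q + extraEdgess ps qs ≡ᵇ 0))))
        ≡⟨ cong (∑ A (aboveBys 1 ps) +_) (∑-cong (λ q → ∑-cong (λ qs →
             𝟙-∧-+≡ᵇ0 true (leqs ps qs) (rank q) (extraEdgess ps qs)) A) P) ⟩
      ∑ A (aboveBys 1 ps) + ∑ P (λ q → ∑ A (λ qs → 𝟙 (rank q ≡ᵇ 0) * aboveBys 0 ps qs))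
        ≡⟨ cong (∑ A (aboveBys 1 ps) +_) (∑-product P A _ _) ⟩
      ∑ A (aboveBys 1 ps) + ∑ P (λ q → 𝟙 (rank q ≡ᵇ 0)) * ∑ A (aboveBys 0 ps)
        ≡⟨ cong₂ _+_ (∑-aboveBys-1 ps) (cong₂ _*_ (∑-rank≡0 t) (∑-aboveBys-0 ps)) ⟩
      boundaryEdgess ps + 1
        ≡⟨ +-comm _ 1 ⟩
      suc (boundaryEdgess ps) ∎
      where
      A : List (Prunings ts)
      A = allPruningss ts
      P : List (Pruning t)
      P = allPrunings t
    ∑-aboveBys-1 {t ∷ ts} (keep p ps) = begin
      ∑ (allPruningss (t ∷ ts)) (aboveBys 1 (keep p ps))
        ≡⟨ ∑-allPruningss-∷ (aboveBys 1 (keep p ps)) ⟩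
      ∑ A (λ _ → 0) + ∑ P (λ q → ∑ A (aboveBys 1 (keep p ps) ∘ keep q))
        ≡⟨ cong₂ _+_ (∑-zero A) (∑-cong (λ q → ∑-cong (λ qs →
             𝟙-∧-+≡ᵇ1 (leq p q) (leqs ps qs) (extraEdges p q) (extraEdgess ps qs)) A) P) ⟩
      ∑ P (λ q → ∑ A (λ qs → aboveBy 1 p q * aboveBys 0 ps qs + aboveBy 0 p q * aboveBys 1 ps qs))
        ≡⟨ ∑-product-+ P A (aboveBy 1 p) (aboveBy 0 p) (aboveBys 0 ps) (aboveBys 1 ps) ⟩
      ∑ P (aboveBy 1 p) * ∑ A (aboveBys 0 ps) + ∑ P (aboveBy 0 p) * ∑ A (aboveBys 1 ps)
        ≡⟨ cong₂ _+_ (cong₂ _*_ (∑-aboveBy-1 p) (∑-aboveBys-0 ps))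
                     (cong₂ _*_ (∑-aboveBy-0 p) (∑-aboveBys-1 ps)) ⟩
      boundaryEdges p * 1 + 1 * boundaryEdgess ps
        ≡⟨ cong₂ _+_ (*-identityʳ (boundaryEdges p)) (*-identityˡ (boundaryEdgess ps)) ⟩
      boundaryEdges p + boundaryEdgess ps ∎
      where
      A : List (Prunings ts)
      A = allPruningss ts
      P : List (Pruning t)
      P = allPrunings t

  coverCount≡boundaryEdges : ∀ {t} (S : Pruning t) → coverCount S ≡ boundaryEdges S
  coverCount≡boundaryEdges {t} S = begin
    coverCount S                      ≡⟨ length-filterᵇ (covers S) (allPrunings t) ⟩
    ∑ (allPrunings t) (𝟙 ∘ covers S)  ≡⟨ ∑-cong (cong 𝟙 ∘ covers≡leq∧extraEdges≡ᵇ1 S) (allPrunings t) ⟩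
    ∑ (allPrunings t) (aboveBy 1 S)   ≡⟨ ∑-aboveBy-1 S ⟩
    boundaryEdges S                   ∎

mutual
  φ₋₁≡ᵇ1 : Tree → Bool
  φ₋₁≡ᵇ1 (node ts) = φs₋₁≡ᵇ1 ts

  φs₋₁≡ᵇ1 : List Tree → Bool
  φs₋₁≡ᵇ1 []       = true
  φs₋₁≡ᵇ1 (t ∷ ts) = not (φ₋₁≡ᵇ1 t) ∧ φs₋₁≡ᵇ1 ts

module _ {c ℓ : Level} (R : CommutativeRing c ℓ) where
  open CommutativeRing R
  open Poly R
  open FiniteSum commutativeSemiring using (𝟙)
  open import Algebra.Properties.Ring ring using (-1*x≈-x)

  [1-𝟙a]𝟙b≈𝟙[¬a∧b] : ∀ a b → (1# + - 1# * 𝟙 a) * 𝟙 b ≈ 𝟙 (not a ∧ b)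
  [1-𝟙a]𝟙b≈𝟙[¬a∧b] true  b     = trans (*-congʳ (trans (+-congˡ (-1*x≈-x 1#)) (-‿inverseʳ 1#))) (zeroˡ _)
  [1-𝟙a]𝟙b≈𝟙[¬a∧b] false true  = trans (*-identityʳ _) (trans (+-congˡ (zeroʳ _)) (+-identityʳ 1#))
  [1-𝟙a]𝟙b≈𝟙[¬a∧b] false false = zeroʳ _

  mutual
    φ-atMinusOne : ∀ t → φ (- 1#) t ≈ 𝟙 (φ₋₁≡ᵇ1 t)
    φ-atMinusOne (node ts) = φs-atMinusOne ts

    φs-atMinusOne : ∀ ts → φs (- 1#) ts ≈ 𝟙 (φs₋₁≡ᵇ1 ts)
    φs-atMinusOne []       = refl
    φs-atMinusOne (t ∷ ts) =
      trans (*-cong (+-congˡ (*-congˡ (φ-atMinusOne t))) (φs-atMinusOne ts))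
            ([1-𝟙a]𝟙b≈𝟙[¬a∧b] (φ₋₁≡ᵇ1 t) (φs₋₁≡ᵇ1 ts))

φAtMinusOneIsOne≡φ₋₁≡ᵇ1 : ∀ {t} (S : Pruning t) → φAtMinusOneIsOne S ≡.≡ φ₋₁≡ᵇ1 (toTree S)
φAtMinusOneIsOne≡φ₋₁≡ᵇ1 S
  with φℤ (ℤ.- ℤ.1ℤ) (toTree S) ℤ.≟ ℤ.1ℤ | φ-atMinusOne +-*-commutativeRing (toTree S)
... | yes φ≡1 | φ≡ with φ₋₁≡ᵇ1 (toTree S)
...   | true  = ≡.refl
...   | false = contradiction (≡.trans (≡.sym φ≡1) φ≡) λ ()
φAtMinusOneIsOne≡φ₋₁≡ᵇ1 S | no φ≢1 | φ≡ with φ₋₁≡ᵇ1 (toTree S)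
...   | true  = contradiction φ≡ φ≢1
...   | false = ≡.refl

-- Weighted sums over prunings

module _ {c ℓ : Level} (R : CommutativeRing c ℓ) (q : CommutativeRing.Carrier R) where
  open CommutativeRing R
  open Poly R
  open RHS R
  open FiniteSum commutativeSemiring
  open import Relation.Binary.Reasoning.Setoid setoid
  open import Algebra.Properties.Ring ring using (-1*x≈-x; -‿distribˡ-*; -‿involutive)
  open import Algebra.Properties.CommutativeSemigroup *-commutativeSemigroup using (interchange; x∙yz≈y∙xz)

  pow-+ : ∀ x m n → pow x (m ℕ.+ n) ≈ pow x m * pow x n
  pow-+ x ℕ.zero    n = sym (*-identityˡ _)
  pow-+ x (ℕ.suc m) n = trans (*-congˡ (pow-+ x m n)) (sym (*-assoc x _ _))

  weight : ∀ {t} → Pruning t → Carrier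
  weight S = pow (- q) (rank S) * pow (1# + q) (boundaryEdges S)

  weights : ∀ {ts} → Prunings ts → Carrier
  weights ps = pow (- q) (ranks ps) * pow (1# + q) (boundaryEdgess ps)

  weights-drop : ∀ {t ts} (ps : Prunings ts) → weights (drop {t} ps) ≈ (1# + q) * weights ps
  weights-drop ps = x∙yz≈y∙xz _ _ _

  weights-keep : ∀ {t ts} (p : Pruning t) (ps : Prunings ts) →
                 weights (keep p ps) ≈ ((- q) * weight p) * weights ps
  weights-keep p ps = begin
    ((- q) * pow (- q) (r₁ ℕ.+ r₂)) * pow (1# + q) (b₁ ℕ.+ b₂)
      ≈⟨ *-cong (*-congˡ (pow-+ (- q) r₁ r₂)) (pow-+ (1# + q) b₁ b₂) ⟩
    ((- q) * (pow (- q) r₁ * pow (- q) r₂)) * (pow (1# + q) b₁ * pow (1# + q) b₂)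
      ≈⟨ *-congʳ (*-assoc (- q) _ _) ⟨
    (((- q) * pow (- q) r₁) * pow (- q) r₂) * (pow (1# + q) b₁ * pow (1# + q) b₂)
      ≈⟨ interchange _ _ _ _ ⟩
    (((- q) * pow (- q) r₁) * pow (1# + q) b₁) * (pow (- q) r₂ * pow (1# + q) b₂)
      ≈⟨ *-congʳ (*-assoc (- q) _ _) ⟩
    ((- q) * weight p) * weights ps ∎
    where
    r₁ b₁ r₂ b₂ : ℕ.ℕ
    r₁ = rank p
    b₁ = boundaryEdges p
    r₂ = ranks ps
    b₂ = boundaryEdgess ps

  1+q-q≈1 : (1# + q) + (- q) * 1# ≈ 1#
  1+q-q≈1 = begin
    (1# + q) + (- q) * 1#  ≈⟨ +-congˡ (*-identityʳ (- q)) ⟩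
    (1# + q) + - q         ≈⟨ +-assoc 1# q (- q) ⟩
    1# + (q + - q)         ≈⟨ +-congˡ (-‿inverseʳ q) ⟩
    1# + 0#                ≈⟨ +-identityʳ 1# ⟩
    1#                     ∎

  mutual
    ∑-weight : ∀ t → ∑ (allPrunings t) weight ≈ 1#
    ∑-weight (node ts) = trans (reflexive (∑-allPrunings-node {ts} weight)) (∑-weights ts)

    ∑-weights : ∀ ts → ∑ (allPruningss ts) weights ≈ 1#
    ∑-weights []       = trans (+-identityʳ _) (*-identityʳ 1#)
    ∑-weights (t ∷ ts) = begin
      ∑ (allPruningss (t ∷ ts)) weights
        ≈⟨ ∑-allPruningss-∷-factor {t} {ts} weights (1# + q) (λ p → (- q) * weight p) weights
             (weights-drop {t}) weights-keep ⟩
      ((1# + q) + ∑ (allPrunings t) (λ p → (- q) * weight p)) * ∑ (allPruningss ts) weights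
        ≈⟨ *-cong (+-congˡ (trans (∑-*ˡ (- q) (allPrunings t) weight) (*-congˡ (∑-weight t)))) (∑-weights ts) ⟩
      ((1# + q) + (- q) * 1#) * 1#
        ≈⟨ trans (*-identityʳ _) 1+q-q≈1 ⟩
      1# ∎

  [1-x][-qy]≈-qy+qxy : ∀ x y → (1# + - 1# * x) * ((- q) * y) ≈ (- q) * y + q * (x * y)
  [1-x][-qy]≈-qy+qxy x y = begin
    (1# + - 1# * x) * ((- q) * y)               ≈⟨ distribʳ _ 1# (- 1# * x) ⟩
    1# * ((- q) * y) + (- 1# * x) * ((- q) * y) ≈⟨ +-cong (*-identityˡ _) (*-congʳ (-1*x≈-x x)) ⟩
    (- q) * y + (- x) * ((- q) * y)             ≈⟨ +-congˡ (-‿distribˡ-* x _) ⟨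
    (- q) * y + - (x * ((- q) * y))             ≈⟨ +-congˡ (-‿cong (x∙yz≈y∙xz x (- q) y)) ⟩
    (- q) * y + - ((- q) * (x * y))             ≈⟨ +-congˡ (-‿cong (-‿distribˡ-* q (x * y))) ⟨
    (- q) * y + - - (q * (x * y))               ≈⟨ +-congˡ (-‿involutive _) ⟩
    (- q) * y + q * (x * y)                     ∎

  mutual
    ∑-φ₋₁-weight : ∀ t → ∑ (allPrunings t) (λ S → φ (- 1#) (toTree S) * weight S) ≈ φ q t
    ∑-φ₋₁-weight (node ts) =
      trans (reflexive (∑-allPrunings-node {ts} (λ S → φ (- 1#) (toTree S) * weight S))) (∑-φs₋₁-weights ts)

    ∑-φs₋₁-weights : ∀ ts → ∑ (allPruningss ts) (λ ps → φs (- 1#) (toTrees ps) * weights ps) ≈ φs q ts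
    ∑-φs₋₁-weights []       = trans (+-identityʳ _) (trans (*-identityˡ _) (*-identityʳ 1#))
    ∑-φs₋₁-weights (t ∷ ts) = begin
      ∑ (allPruningss (t ∷ ts)) g
        ≈⟨ ∑-allPruningss-∷-factor {t} {ts} g (1# + q) h g g-drop g-keep ⟩
      ((1# + q) + ∑ (allPrunings t) h) * ∑ (allPruningss ts) g
        ≈⟨ *-cong (+-congˡ ∑h) (∑-φs₋₁-weights ts) ⟩
      ((1# + q) + ((- q) * 1# + q * φ q t)) * φs q ts
        ≈⟨ *-congʳ (trans (sym (+-assoc _ _ _)) (+-congʳ 1+q-q≈1)) ⟩
      (1# + q * φ q t) * φs q ts ∎
      where
      g : ∀ {ts} → Prunings ts → Carrier
      g ps = φs (- 1#) (toTrees ps) * weights ps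

      φ₋₁ : Pruning t → Carrier
      φ₋₁ p = φ (- 1#) (toTree p)

      h : Pruning t → Carrier
      h p = (1# + - 1# * φ₋₁ p) * ((- q) * weight p)

      g-drop : ∀ ps → g (drop {t} ps) ≈ (1# + q) * g ps
      g-drop ps = trans (*-congˡ (weights-drop {t} ps)) (x∙yz≈y∙xz _ _ _)

      g-keep : ∀ p ps → g (keep p ps) ≈ h p * g ps
      g-keep p ps = trans (*-congˡ (weights-keep p ps)) (interchange _ _ _ _)

      ∑h : ∑ (allPrunings t) h ≈ (- q) * 1# + q * φ q t
      ∑h = begin
        ∑ (allPrunings t) h
          ≈⟨ ∑-cong (λ p → [1-x][-qy]≈-qy+qxy (φ₋₁ p) (weight p)) (allPrunings t) ⟩
        ∑ (allPrunings t) (λ p → (- q) * weight p + q * (φ₋₁ p * weight p))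
          ≈⟨ ∑-+ (allPrunings t) _ _ ⟩
        ∑ (allPrunings t) (λ p → (- q) * weight p) + ∑ (allPrunings t) (λ p → q * (φ₋₁ p * weight p))
          ≈⟨ +-cong (∑-*ˡ (- q) (allPrunings t) weight) (∑-*ˡ q (allPrunings t) _) ⟩
        (- q) * ∑ (allPrunings t) weight + q * ∑ (allPrunings t) (λ p → φ₋₁ p * weight p)
          ≈⟨ +-cong (*-congˡ (∑-weight t)) (*-congˡ (∑-φ₋₁-weight t)) ⟩
        (- q) * 1# + q * φ q t ∎

  rhs≈∑-φ₋₁-weight : ∀ T → rhs q T ≈ ∑ (allPrunings T) (λ S → φ (- 1#) (toTree S) * weight S)
  rhs≈∑-φ₋₁-weight T = trans (∑-filterᵇ φAtMinusOneIsOne (allPrunings T) _) (∑-cong select (allPrunings T))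
    where
    select : ∀ S → 𝟙 (φAtMinusOneIsOne S) * (pow (- q) (rank S) * pow (1# + q) (coverCount S)) ≈
                   φ (- 1#) (toTree S) * weight S
    select S = *-cong
      (trans (reflexive (≡.cong 𝟙 (φAtMinusOneIsOne≡φ₋₁≡ᵇ1 S))) (sym (φ-atMinusOne R (toTree S))))
      (reflexive (≡.cong (λ n → pow (- q) (rank S) * pow (1# + q) n) (coverCount≡boundaryEdges S)))

mainTheorem6 : ∀ {c ℓ : Level} (R : CommutativeRing c ℓ) (T : Tree) (q : CommutativeRing.Carrier R) →
    CommutativeRing._≈_ R (Poly.φ R q T) (RHS.rhs R q T)
mainTheorem6 R T q = begin
  φ q T                                                        ≈⟨ ∑-φ₋₁-weight R q T ⟨
  ∑ (allPrunings T) (λ S → φ (- 1#) (toTree S) * weight R q S) ≈⟨ rhs≈∑-φ₋₁-weight R q T ⟨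
  rhs q T                                                      ∎
  where
  open CommutativeRing R
  open Poly R
  open RHS R
  open FiniteSum commutativeSemiring
  open import Relation.Binary.Reasoning.Setoid setoid
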